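{- For each integer $k\ge 2$, there exists a complete tripartite graph that is uniquely $k$-list colorable.
   Context: All graphs are finite, simple and undirected. Given a graph $G$ and a list $L(v)$ of colors assigned to each vertex $v$, an $L$-coloring is a proper vertex coloring $c$ of $G$ with $c(v)\in L(v)$ for every vertex $v$. A graph $G$ is uniquely $k$-list colorable if there exist lists $L(v)$, each consisting of exactly $k$ colors, such that $G$ has exactly one $L$-coloring. -}

module Defs where

open import Level using (0ℓ)
open import Data.Nat using (ℕ; _≥_)
open import Data.Fin using (Fin)
open import Data.List using (List; length)
open import Data.List.Membership.Propositional using (_∈_)
open import Data.List.Relation.Unary.Unique.Propositional using (Unique)
open import Data.Product using (Σ; ∃; ∃-syntax; _×_)
open import Relation.Binary.PropositionalEquality using (_≡_; _≢_)
open import Relation.Nullary using (¬_)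
open import Function.Bundles using (_⇔_)

record Graph : Set₁ where
  field
    n      : ℕ
    Adj    : Fin n → Fin n → Set
    sym    : ∀ {u v} → Adj u v → Adj v u
    irrefl : ∀ {v} → ¬ Adj v v
open Graph public

IsCompleteTripartite : Graph → Set
IsCompleteTripartite G =
  Σ (Fin (n G) → Fin 3) λ part →
    (∀ (i : Fin 3) → ∃[ v ] (part v ≡ i))
    × (∀ u v → Adj G u v ⇔ (part u ≢ part v))

ListAssignment : Graph → Set
ListAssignment G = Fin (n G) → List ℕ

IsKAssignment : (G : Graph) → ℕ → ListAssignment G → Set
IsKAssignment G k L = ∀ v → Unique (L v) × length (L v) ≡ k

IsLColoring : (G : Graph) → ListAssignment G → (Fin (n G) → ℕ) → Set
IsLColoring G L c = (∀ v → c v ∈ L v) × (∀ u v → Adj G u v → c u ≢ c v)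

UniqueLColoring : (G : Graph) → ListAssignment G → Set
UniqueLColoring G L =
  ∃[ c ] (IsLColoring G L c × (∀ c′ → IsLColoring G L c′ → ∀ v → c′ v ≡ c v))

UniquelyListColorable : Graph → ℕ → Set
UniquelyListColorable G k =
  ∃[ L ] (IsKAssignment G k L × UniqueLColoring G L)

{-# OPTIONS --safe #-}

-- Let K = k − 1 and take colors α i s (i < K, s ≤ K) and γ j (j < K). The first part has
-- vertices A i with list {α i s | s ≤ K}; the second has vertices B i s (s < K) with list
-- {α i (s + 1)} ∪ {γ j | j < K}; the third has, for every j and every choice t of one color
-- α i (t i) from each block, a vertex C t j with list {γ j} ∪ {α i (t i) | i < K}.
-- In a list coloring let A i take α i (τ i). Then every C τ j is forced onto γ j, so all the
-- γ j are used on the third part and B i s must take α i (s + 1). That leaves only α i 0 for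
-- A i, and then no C t j can take an α-color, so C t j takes γ j.
module Submission where

open import Defs
open import Data.Nat using (ℕ; _≥_; zero; suc; s≤s; z≤n)
open import Data.Fin using (Fin; zero; suc; toℕ)
open import Data.Fin.Patterns using (0F; 1F; 2F)
import Data.Fin as Fin
open import Data.Fin.Properties using (toℕ-injective)
open import Data.Vec using (Vec; []; _∷_; lookup; replicate)
import Data.Vec as Vec
import Data.Vec.Properties as Vecₚ
open import Data.List
  using (List; []; _∷_; [_]; _++_; map; length; tabulate; allFin; cartesianProduct; cartesianProductWith)
import Data.List as List
open import Data.List.Properties using (length-map; length-tabulate)
open import Data.List.Relation.Unary.Any using (here; there; index)
open import Data.List.Relation.Unary.Any.Properties using (lookup-index)
import Data.List.Relation.Unary.All.Properties as Allₚ
open import Data.List.Relation.Unary.AllPairs using (_∷_)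
open import Data.List.Membership.Propositional using (_∈_)
open import Data.List.Membership.Propositional.Properties
  using ( ∈-map⁺; ∈-map⁻; ∈-++⁺ˡ; ∈-++⁺ʳ; ∈-tabulate⁺; ∈-tabulate⁻; ∈-allFin
        ; ∈-cartesianProduct⁺; ∈-cartesianProductWith⁺)
open import Data.List.Relation.Unary.Unique.Propositional using (Unique)
import Data.List.Relation.Unary.Unique.Propositional.Properties as Uniqueₚ
open import Data.Sum using (_⊎_; inj₁; inj₂)
import Data.Sum.Properties as Sumₚ
open import Data.Product using (∃-syntax; _×_; _,_; proj₁; proj₂)
import Data.Product.Properties as Productₚ
open import Data.Empty using (⊥; ⊥-elim)
open import Function using (_∘_; id)
open import Function.Bundles using (mk⇔)
open import Function.Definitions using (Injective)
open import Relation.Nullary using (yes; no; contradiction)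
open import Relation.Binary.Definitions using (DecidableEquality)
open import Relation.Binary.PropositionalEquality as ≡
  using (_≡_; _≢_; refl; trans; cong; subst; subst₂)
open ≡.≡-Reasoning

record Enumeration (A : Set) : Set where
  field
    elements : List A
    complete : ∀ x → x ∈ elements

  size : ℕ
  size = length elements

  element : Fin size → A
  element = List.lookup elements

  position : A → Fin size
  position x = index (complete x)

  element-position : ∀ x → element (position x) ≡ x
  element-position x = ≡.sym (lookup-index (complete x))

  code : A → ℕ
  code x = toℕ (position x)

  code-injective : Injective _≡_ _≡_ code
  code-injective {x} {y} eq = begin
    x                     ≡⟨ ≡.sym (element-position x) ⟩
    element (position x)  ≡⟨ cong element (toℕ-injective eq) ⟩
    element (position y)  ≡⟨ element-position y ⟩
    y                     ∎

open Enumeration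

Fin-enumeration : ∀ n → Enumeration (Fin n)
Fin-enumeration n = record { elements = allFin n ; complete = ∈-allFin }

module _ {A B : Set} (E : Enumeration A) (F : Enumeration B) where

  ⊎-enumeration : Enumeration (A ⊎ B)
  ⊎-enumeration = record
    { elements = map inj₁ (elements E) ++ map inj₂ (elements F)
    ; complete = λ where
        (inj₁ x) → ∈-++⁺ˡ (∈-map⁺ inj₁ (complete E x))
        (inj₂ y) → ∈-++⁺ʳ _ (∈-map⁺ inj₂ (complete F y))
    }

  ×-enumeration : Enumeration (A × B)
  ×-enumeration = record
    { elements = cartesianProduct (elements E) (elements F)
    ; complete = λ (x , y) → ∈-cartesianProduct⁺ (complete E x) (complete F y)
    }

Vec-enumeration : {A : Set} → Enumeration A → ∀ r → Enumeration (Vec A r)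
Vec-enumeration E zero = record { elements = [ [] ] ; complete = λ { [] → here refl } }
Vec-enumeration E (suc r) = record
  { elements = cartesianProductWith _∷_ (elements E) (elements Eʳ)
  ; complete = λ { (x ∷ xs) → ∈-cartesianProductWith⁺ _∷_ (complete E x) (complete Eʳ xs) }
  }
  where Eʳ = Vec-enumeration E r

module _ {V C : Set} (Adj : V → V → Set) (L : V → List C) where

  IsListColoring : (V → C) → Set
  IsListColoring c = (∀ v → c v ∈ L v) × (∀ u v → Adj u v → c u ≢ c v)

  IsUniqueListColoring : (V → C) → Set
  IsUniqueListColoring c = IsListColoring c × (∀ c′ → IsListColoring c′ → ∀ v → c′ v ≡ c v)

module _ {X V C : Set} {Adj : V → V → Set} {L : V → List C}
         (f : X → V) (_≟_ : DecidableEquality V)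
         (section : V → X) (f∘section : ∀ v → f (section v) ≡ v) where

  sectionThrough : X → V → X
  sectionThrough x v with v ≟ f x
  ... | yes _ = x
  ... | no _  = section v

  f∘sectionThrough : ∀ x v → f (sectionThrough x v) ≡ v
  f∘sectionThrough x v with v ≟ f x
  ... | yes v≡fx = ≡.sym v≡fx
  ... | no _     = f∘section v

  sectionThrough-base : ∀ x → sectionThrough x (f x) ≡ x
  sectionThrough-base x with f x ≟ f x
  ... | yes _    = refl
  ... | no fx≢fx = contradiction refl fx≢fx

  isListColoring-restrict : ∀ {c} (s : V → X) → (∀ v → f (s v) ≡ v) →
                            IsListColoring (λ x y → Adj (f x) (f y)) (L ∘ f) c →
                            IsListColoring Adj L (c ∘ s)
  isListColoring-restrict {c} s f∘s (c∈ , proper) =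
      (λ v → subst (λ w → c (s v) ∈ L w) (f∘s v) (c∈ (s v)))
    , (λ u v adj → proper (s u) (s v) (subst₂ Adj (≡.sym (f∘s u)) (≡.sym (f∘s v)) adj))

  isUniqueListColoring-pullback : ∀ {c₀} → IsUniqueListColoring Adj L c₀ →
                                  IsUniqueListColoring (λ x y → Adj (f x) (f y)) (L ∘ f) (c₀ ∘ f)
  isUniqueListColoring-pullback {c₀} ((c₀∈ , proper) , unique) =
    ((c₀∈ ∘ f) , (λ x y → proper (f x) (f y))) , λ c c-col x → begin
      c x                         ≡⟨ cong c (≡.sym (sectionThrough-base x)) ⟩
      c (sectionThrough x (f x))  ≡⟨ unique (c ∘ sectionThrough x)
                                            (isListColoring-restrict (sectionThrough x)
                                                                     (f∘sectionThrough x) c-col)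
                                            (f x) ⟩
      c₀ (f x)                    ∎

module _ {V C D : Set} {Adj : V → V → Set} {L : V → List C} (code : C → D) where

  isListColoring-decode : ∀ {c} → IsListColoring Adj (map code ∘ L) c →
                          ∃[ c̃ ] (IsListColoring Adj L c̃ × (∀ v → c v ≡ code (c̃ v)))
  isListColoring-decode {c} (c∈ , proper) = c̃ , (c̃∈ , c̃-proper) , c≡code∘c̃
    where
    preimage : ∀ v → ∃[ a ] (a ∈ L v × c v ≡ code a)
    preimage v = ∈-map⁻ code (c∈ v)
    c̃ : V → C
    c̃ v = proj₁ (preimage v)
    c̃∈ : ∀ v → c̃ v ∈ L v
    c̃∈ v = proj₁ (proj₂ (preimage v))
    c≡code∘c̃ : ∀ v → c v ≡ code (c̃ v)
    c≡code∘c̃ v = proj₂ (proj₂ (preimage v))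
    c̃-proper : ∀ u v → Adj u v → c̃ u ≢ c̃ v
    c̃-proper u v adj c̃u≡c̃v =
      proper u v adj (trans (c≡code∘c̃ u) (trans (cong code c̃u≡c̃v) (≡.sym (c≡code∘c̃ v))))

  isUniqueListColoring-map : Injective _≡_ _≡_ code → ∀ {c₀} → IsUniqueListColoring Adj L c₀ →
                             IsUniqueListColoring Adj (map code ∘ L) (code ∘ c₀)
  isUniqueListColoring-map code-injective {c₀} ((c₀∈ , proper) , unique) =
      ((∈-map⁺ code ∘ c₀∈) , (λ u v adj → proper u v adj ∘ code-injective))
    , λ c c-col v →
        let (c̃ , c̃-col , c≡code∘c̃) = isListColoring-decode c-col
        in trans (c≡code∘c̃ v) (cong code (unique c̃ c̃-col v))

-- Enumerations may repeat elements, so this is in general a blow-up of the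
-- multipartite structure on V by independent copies; see isUniqueListColoring-pullback.
multipartite : {V P : Set} → Enumeration V → (V → P) → Graph
multipartite E part = record
  { n      = size E
  ; Adj    = λ u v → part (element E u) ≢ part (element E v)
  ; sym    = λ u≁v eq → u≁v (≡.sym eq)
  ; irrefl = λ v≁v → v≁v refl
  }

multipartite-isCompleteTripartite : {V : Set} (E : Enumeration V) (part : V → Fin 3) →
                                    (∀ p → ∃[ v ] (part v ≡ p)) →
                                    IsCompleteTripartite (multipartite E part)
multipartite-isCompleteTripartite E part part-surjective =
    part ∘ element E
  , (λ p → let (v , part-v) = part-surjective p
           in position E v , trans (cong part (element-position E v)) part-v)
  , λ u v → mk⇔ id id

multipartite-uniquelyListColorable :
  {V P C : Set} (E : Enumeration V) → DecidableEquality V → Enumeration C →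
  (part : V → P) (L : V → List C) {k : ℕ} {c₀ : V → C} →
  (∀ v → Unique (L v) × length (L v) ≡ k) →
  IsUniqueListColoring (λ v w → part v ≢ part w) L c₀ →
  UniquelyListColorable (multipartite E part) k
multipartite-uniquelyListColorable E _≟_ colors part L {c₀ = c₀} L-kList c₀-unique =
    (λ u → map (code colors) (L (element E u)))
  , (λ u → let (L-unique , L-length) = L-kList (element E u)
           in Uniqueₚ.map⁺ (code-injective colors) L-unique
            , trans (length-map (code colors) (L (element E u))) L-length)
  , code colors ∘ c₀ ∘ element E
  , isUniqueListColoring-map (code colors) (code-injective colors)
      (isUniqueListColoring-pullback (element E) _≟_ (position E) (element-position E) c₀-unique)

module Construction (K : ℕ) where

  Color : Set
  Color = (Fin K × Fin (suc K)) ⊎ Fin K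

  pattern α i s = inj₁ (i , s)
  pattern γ j   = inj₂ j

  Vertex : Set
  Vertex = Fin K ⊎ (Fin K × Fin K) ⊎ (Vec (Fin (suc K)) K × Fin K)

  pattern A i   = inj₁ i
  pattern B i s = inj₂ (inj₁ (i , s))
  pattern C t j = inj₂ (inj₂ (t , j))

  part : Vertex → Fin 3
  part (A _)   = 0F
  part (B _ _) = 1F
  part (C _ _) = 2F

  lists : Vertex → List Color
  lists (A i)   = tabulate (α i)
  lists (B i s) = α i (suc s) ∷ tabulate γ
  lists (C t j) = γ j ∷ tabulate (λ i → α i (lookup t i))

  color₀ : Vertex → Color
  color₀ (A i)   = α i zero
  color₀ (B i s) = α i (suc s)
  color₀ (C _ j) = γ j

  Adjacent : Vertex → Vertex → Set
  Adjacent v w = part v ≢ part w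

  colors : Enumeration Color
  colors = ⊎-enumeration (×-enumeration (Fin-enumeration K) (Fin-enumeration (suc K)))
                         (Fin-enumeration K)

  vertices : Enumeration Vertex
  vertices = ⊎-enumeration (Fin-enumeration K)
               (⊎-enumeration (×-enumeration (Fin-enumeration K) (Fin-enumeration K))
                              (×-enumeration (Vec-enumeration (Fin-enumeration (suc K)) K) (Fin-enumeration K)))

  _≟ᵛ_ : DecidableEquality Vertex
  _≟ᵛ_ = Sumₚ.≡-dec Fin._≟_ (Sumₚ.≡-dec (Productₚ.≡-dec Fin._≟_ Fin._≟_)
                                      (Productₚ.≡-dec (Vecₚ.≡-dec Fin._≟_) Fin._≟_))

  part-surjective : Fin K → ∀ p → ∃[ v ] (part v ≡ p)
  part-surjective i 0F = A i , refl
  part-surjective i 1F = B i i , refl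
  part-surjective i 2F = C (replicate K zero) i , refl

  α≢γ : ∀ {i : Fin K} {s : Fin (suc K)} {j : Fin K} → α i s ≢ γ j
  α≢γ ()

  lists-unique : ∀ v → Unique (lists v)
  lists-unique (A i)   = Uniqueₚ.tabulate⁺ {f = α i} λ { refl → refl }
  lists-unique (B i s) = Allₚ.tabulate⁺ (λ _ → α≢γ) ∷ Uniqueₚ.tabulate⁺ λ { refl → refl }
  lists-unique (C t j) = Allₚ.tabulate⁺ (λ _ → α≢γ ∘ ≡.sym) ∷ Uniqueₚ.tabulate⁺ α-injective
    where
    α-injective : ∀ {i i′} → α i (lookup t i) ≡ α i′ (lookup t i′) → i ≡ i′
    α-injective refl = refl

  lists-length : ∀ v → length (lists v) ≡ suc K
  lists-length (A i)   = length-tabulate (α i)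
  lists-length (B i s) = cong suc (length-tabulate γ)
  lists-length (C t j) = cong suc (length-tabulate _)

  color₀-isListColoring : IsListColoring Adjacent lists color₀
  color₀-isListColoring = color₀∈lists , λ u v u≁v eq →
    u≁v (trans (≡.sym (partOf-color₀ u)) (trans (cong partOf eq) (partOf-color₀ v)))
    where
    color₀∈lists : ∀ v → color₀ v ∈ lists v
    color₀∈lists (A i)   = ∈-tabulate⁺ {f = α i} zero
    color₀∈lists (B i s) = here refl
    color₀∈lists (C t j) = here refl
    partOf : Color → Fin 3
    partOf (α _ zero)    = 0F
    partOf (α _ (suc _)) = 1F
    partOf (γ _)         = 2F
    partOf-color₀ : ∀ v → partOf (color₀ v) ≡ part v
    partOf-color₀ (A _)   = refl
    partOf-color₀ (B _ _) = refl
    partOf-color₀ (C _ _) = refl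

  module Forced {c : Vertex → Color} (c∈ : ∀ v → c v ∈ lists v)
                (proper : ∀ v w → Adjacent v w → c v ≢ c w) where

    clash : ∀ v w {x} → Adjacent v w → c v ≡ x → c w ≡ x → ⊥
    clash v w v≁w cv≡x cw≡x = proper v w v≁w (trans cv≡x (≡.sym cw≡x))

    A-color : ∀ i → ∃[ s ] (c (A i) ≡ α i s)
    A-color i = ∈-tabulate⁻ (c∈ (A i))

    τ : Vec (Fin (suc K)) K
    τ = Vec.tabulate (proj₁ ∘ A-color)

    C-τ-color : ∀ j → c (C τ j) ≡ γ j
    C-τ-color j with c∈ (C τ j)
    ... | here eq = eq
    ... | there c∈α with ∈-tabulate⁻ c∈α
    ...   | i , eq = ⊥-elim (clash (C τ j) (A i) (λ ())
                                       (trans eq (cong (α i) (Vecₚ.lookup∘tabulate _ i)))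
                                       (proj₂ (A-color i)))

    B-color : ∀ i s → c (B i s) ≡ α i (suc s)
    B-color i s with c∈ (B i s)
    ... | here eq = eq
    ... | there c∈γ with ∈-tabulate⁻ c∈γ
    ...   | j , eq = ⊥-elim (clash (B i s) (C τ j) (λ ()) eq (C-τ-color j))

    A-color-zero : ∀ i → c (A i) ≡ α i zero
    A-color-zero i with A-color i
    ... | zero  , eq = eq
    ... | suc s , eq = ⊥-elim (clash (A i) (B i s) (λ ()) eq (B-color i s))

    C-color : ∀ t j → c (C t j) ≡ γ j
    C-color t j with c∈ (C t j)
    ... | here eq = eq
    ... | there c∈α with ∈-tabulate⁻ c∈α
    ...   | i , eq with lookup t i
    ...     | zero  = ⊥-elim (clash (C t j) (A i) (λ ()) eq (A-color-zero i))
    ...     | suc s = ⊥-elim (clash (C t j) (B i s) (λ ()) eq (B-color i s))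

    forced : ∀ v → c v ≡ color₀ v
    forced (A i)   = A-color-zero i
    forced (B i s) = B-color i s
    forced (C t j) = C-color t j

  color₀-isUniqueListColoring : IsUniqueListColoring Adjacent lists color₀
  color₀-isUniqueListColoring =
    color₀-isListColoring , λ c (c∈ , proper) → Forced.forced c∈ proper

theorem3p1 : (k : ℕ) → k ≥ 2 → ∃[ G ] (IsCompleteTripartite G × UniquelyListColorable G k)
theorem3p1 (suc (suc K)) (s≤s (s≤s z≤n)) =
    multipartite vertices part
  , multipartite-isCompleteTripartite vertices part (part-surjective zero)
  , multipartite-uniquelyListColorable vertices _≟ᵛ_ colors part lists
      (λ v → lists-unique v , lists-length v) color₀-isUniqueListColoring
  where open Construction (suc K)
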